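{- Let $\mathcal{A}$ be a complementary alphabet and let $P=p_1p_2\cdots p_{2n}$ be a word in $\mathcal{A}$. If there exists at least one $P$-valid plane tree, then the greedy algorithm applied to $P$ produces a $P$-valid plane tree; that is, it matches every position of $P$, and the resulting set of matched pairs $\{i,j\}$ is the set of edges $e(i,j)$ of a plane tree with $n$ edges which is $P$-valid.
   Context: A complementary alphabet $\mathcal{A}$ is a finite set in which every letter $B$ has a unique complement $\overline{B}\in\mathcal{A}$, with $\overline{B}\neq B$ and $\overline{\overline{B}}=B$. A plane tree is a rooted tree in which the children of each vertex are linearly ordered. For a plane tree with $n$ edges, label the $2n$ half-edges (sides of edges) $1,2,\dots,2n$ by starting on the left side of the leftmost edge at the root and walking around the tree counterclockwise; each edge is written $e(i,j)$ with $i<j$ the labels of its two sides. (Equivalently, the set of edges is a noncrossing perfect matching of $\{1,\dots,2n\}$, and every noncrossing perfect matching arises from exactly one plane tree.) Given a word $P=p_1\cdots p_{2n}$ in $\mathcal{A}$, a plane tree with $n$ edges is $P$-valid if for every edge $e(i,j)$ the letters $p_i$ and $p_j$ are complements. The greedy algorithm on $P$: process positions $i=1,2,\dots,2n$ in order; at position $i$ let $j_i$ be the largest index $j_i<i$ such that position $j_i$ is currently unmatched (if any); if $p_i$ and $p_{j_i}$ are complements, match positions $j_i$ and $i$ (forming the pair/edge $e(j_i,i)$); otherwise leave $i$ unmatched and continue. The output is the set of matched pairs. -}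

module Defs where

open import Data.Nat using (ℕ; zero; suc; _+_; _*_)
open import Data.Fin using (Fin)
open import Data.Fin.Properties using (_≟_)
open import Data.List using (List; []; _∷_; length)
open import Data.Maybe using (Maybe; just; nothing)
open import Data.Product using (_×_; _,_; ∃; ∃-syntax; proj₁; proj₂)
open import Relation.Binary.PropositionalEquality using (_≡_; _≢_)
open import Relation.Nullary using (yes; no)
open import Data.List.Membership.Propositional using (_∈_)

record ComplementaryAlphabet : Set where
  field
    size      : ℕ
    comp      : Fin size → Fin size
    comp-invol : ∀ b → comp (comp b) ≡ b
    comp-neq  : ∀ b → comp b ≢ b

module _ (𝒜 : ComplementaryAlphabet) where
  open ComplementaryAlphabet 𝒜

  Letter : Set
  Letter = Fin size

  Compl : Letter → Letter → Set
  Compl a b = b ≡ comp a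

  Word : Set
  Word = List Letter

  -- 1-indexed letter lookup: P at i is p_i
  _at_ : Word → ℕ → Maybe Letter
  [] at _ = nothing
  (x ∷ xs) at zero = nothing
  (x ∷ xs) at suc zero = just x
  (x ∷ xs) at suc (suc i) = xs at suc i

  ComplAt : Word → ℕ → ℕ → Set
  ComplAt P i j = ∃[ a ] ∃[ b ] (P at i ≡ just a × P at j ≡ just b × Compl a b)

  -- greedy algorithm: the stack holds currently unmatched positions
  -- (with their letters), most recent on top. Returns (matched pairs, unmatched).
  greedyGo : ℕ → List (ℕ × Letter) → Word → List (ℕ × ℕ) × List (ℕ × Letter)
  greedyGo i st [] = [] , st
  greedyGo i [] (x ∷ xs) = greedyGo (suc i) ((i , x) ∷ []) xs
  greedyGo i ((j , y) ∷ st) (x ∷ xs) with x ≟ comp y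
  ... | yes _ = let r = greedyGo (suc i) st xs in ((j , i) ∷ proj₁ r) , proj₂ r
  ... | no _  = greedyGo (suc i) ((i , x) ∷ (j , y) ∷ st) xs

  greedy : Word → List (ℕ × ℕ) × List (ℕ × Letter)
  greedy P = greedyGo 1 [] P

data PlaneTree : Set where
  node : List PlaneTree → PlaneTree

sizeF : List PlaneTree → ℕ
sizeF [] = 0
sizeF (node cs ∷ ts) = suc (sizeF cs + sizeF ts)

edgeCount : PlaneTree → ℕ
edgeCount (node cs) = sizeF cs

-- edges e(i,j) of the children list of a vertex, with half-edge labels
-- starting after offset o, walking counterclockwise.
-- The edge to a child with m edges below gets sides o+1 and o+2m+2.
edgesF : ℕ → List PlaneTree → List (ℕ × ℕ)
edgesF o [] = []
edgesF o (node cs ∷ ts) =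
  (suc o , suc o + suc (2 * sizeF cs)) ∷
  (edgesF (suc o) cs Data.List.++ edgesF (suc o + suc (2 * sizeF cs)) ts)

-- edges of a plane tree, labels 1..2n
edges : PlaneTree → List (ℕ × ℕ)
edges (node cs) = edgesF 0 cs

module _ (𝒜 : ComplementaryAlphabet) where
  Valid : Word 𝒜 → PlaneTree → Set
  Valid P T = ∀ {i j} → (i , j) ∈ edges T → ComplAt 𝒜 P i j

-- A word admitting a P-valid tree is balanced: it splits as a u ā v with u and v
-- balanced.  The greedy stack behaves like free reduction of the letters read so
-- far, and a balanced word reduces to nothing on top of any reduced stack, so
-- greedy leaves no position unmatched.  Recording, alongside the greedy stack,
-- the subtrees completed under each open edge (a zipper) builds a plane forest
-- whose edges are exactly the greedy pairs, and every greedy pair joins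
-- complementary letters by construction.
module Submission where

open import Defs
open import Data.Nat using (ℕ; zero; suc; _+_; _*_)
open import Data.Nat.Properties using (suc-injective; +-suc; +-comm; +-assoc; +-identityʳ; *-cancelˡ-≡)
open import Data.Nat.Tactic.RingSolver using (solve-∀)
open import Data.Fin.Properties using (_≟_)
open import Data.List using (List; []; _∷_; length; _++_; [_]; map; foldl)
open import Data.List.Properties using (length-++; ++-assoc; ++-identityʳ; foldl-++)
open import Data.List.Relation.Unary.All using (All; []; _∷_)
open import Data.List.Relation.Unary.Any using (here; there)
open import Data.List.Membership.Propositional using (_∈_)
open import Data.List.Membership.Propositional.Properties using (∈-++⁺ˡ; ∈-++⁺ʳ)
open import Data.List.Relation.Binary.Permutation.Propositional using (_↭_; ↭-refl; ↭-sym; ↭-trans; ↭-reflexive)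
import Data.List.Relation.Binary.Permutation.Propositional.Properties as ↭
open import Data.Maybe using (just)
open import Data.Product using (_×_; _,_; ∃-syntax; proj₁; proj₂)
open import Data.Empty using (⊥-elim)
open import Data.Unit using (⊤; tt)
open import Relation.Binary.PropositionalEquality
  using (_≡_; _≢_; refl; sym; trans; cong; subst; module ≡-Reasoning)
open import Relation.Nullary using (yes; no)
open import Function.Bundles using (_⇔_; mk⇔)

splitAt-length : ∀ {A : Set} m k (xs : List A) → length xs ≡ m + k
               → ∃[ u ] ∃[ v ] (xs ≡ u ++ v × length u ≡ m × length v ≡ k)
splitAt-length zero    k xs       eq = [] , xs , refl , refl , eq
splitAt-length (suc m) k (x ∷ xs) eq with splitAt-length m k xs (suc-injective eq)
... | u , v , refl , lu , lv = x ∷ u , v , refl , cong suc lu , lv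

map-≡[] : ∀ {A B : Set} {f : A → B} (xs : List A) → map f xs ≡ [] → xs ≡ []
map-≡[] [] _ = refl

sizeF-++ : ∀ F G → sizeF (F ++ G) ≡ sizeF F + sizeF G
sizeF-++ []             G = refl
sizeF-++ (node cs ∷ ts) G = cong suc (begin
  sizeF cs + sizeF (ts ++ G)       ≡⟨ cong (sizeF cs +_) (sizeF-++ ts G) ⟩
  sizeF cs + (sizeF ts + sizeF G)  ≡⟨ +-assoc (sizeF cs) (sizeF ts) (sizeF G) ⟨
  sizeF cs + sizeF ts + sizeF G    ∎)
  where open ≡-Reasoning

2*suc-+ : ∀ m n → 2 * suc (m + n) ≡ suc (2 * m + suc (2 * n))
2*suc-+ = solve-∀

edgesF-++ : ∀ o F G → edgesF o (F ++ G) ≡ edgesF o F ++ edgesF (o + 2 * sizeF F) G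
edgesF-++ o [] G rewrite +-identityʳ o = refl
edgesF-++ o (node cs ∷ ts) G = cong ((suc o , o′) ∷_) (begin
  edgesF (suc o) cs ++ edgesF o′ (ts ++ G)
    ≡⟨ cong (edgesF (suc o) cs ++_) (edgesF-++ o′ ts G) ⟩
  edgesF (suc o) cs ++ edgesF o′ ts ++ edgesF (o′ + 2 * sizeF ts) G
    ≡⟨ ++-assoc (edgesF (suc o) cs) (edgesF o′ ts) _ ⟨
  (edgesF (suc o) cs ++ edgesF o′ ts) ++ edgesF (o′ + 2 * sizeF ts) G
    ≡⟨ cong (λ p → (edgesF (suc o) cs ++ edgesF o′ ts) ++ edgesF p G) (arith o (sizeF cs) (sizeF ts)) ⟩
  (edgesF (suc o) cs ++ edgesF o′ ts) ++ edgesF (o + 2 * sizeF (node cs ∷ ts)) G ∎)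
  where
  open ≡-Reasoning
  o′ : ℕ
  o′ = suc o + suc (2 * sizeF cs)
  arith : ∀ o c t → suc o + suc (2 * c) + 2 * t ≡ o + 2 * suc (c + t)
  arith = solve-∀

edgesF-snoc : ∀ o G F {j i} → j ≡ suc (o + 2 * sizeF G) → i ≡ suc (j + 2 * sizeF F)
            → edgesF o (G ++ [ node F ]) ↭ (j , i) ∷ edgesF j F ++ edgesF o G
edgesF-snoc o G F refl refl
  rewrite edgesF-++ o G [ node F ]
        | +-suc (o + 2 * sizeF G) (2 * sizeF F)
        | ++-identityʳ (edgesF (suc (o + 2 * sizeF G)) F)
  = ↭.++-comm (edgesF o G) _

edgesF-snoc-end : ∀ o G F {j i} → j ≡ suc (o + 2 * sizeF G) → i ≡ suc (j + 2 * sizeF F)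
                → suc i ≡ suc (o + 2 * sizeF (G ++ [ node F ]))
edgesF-snoc-end o G F refl refl rewrite sizeF-++ G [ node F ] = arith o (sizeF G) (sizeF F)
  where
  arith : ∀ o g f → suc (suc (suc (o + 2 * g) + 2 * f)) ≡ suc (o + 2 * (g + suc (f + 0)))
  arith = solve-∀

module _ (𝒜 : ComplementaryAlphabet) where
  open ComplementaryAlphabet 𝒜

  at-++-∷ : ∀ pre (x : Letter 𝒜) rest → _at_ 𝒜 (pre ++ x ∷ rest) (suc (length pre)) ≡ just x
  at-++-∷ []            x rest = refl
  at-++-∷ (_ ∷ [])      x rest = refl
  at-++-∷ (_ ∷ y ∷ pre) x rest = at-++-∷ (y ∷ pre) x rest

  ComplAt⇒≡comp : ∀ {P i j a b} → _at_ 𝒜 P i ≡ just a → _at_ 𝒜 P j ≡ just b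
                → ComplAt 𝒜 P i j → b ≡ comp a
  ComplAt⇒≡comp P[i] P[j] (_ , _ , P[i]′ , P[j]′ , b≡ca) with trans (sym P[i]) P[i]′ | trans (sym P[j]) P[j]′
  ... | refl | refl = b≡ca

  data Balanced : List PlaneTree → Word 𝒜 → Set where
    empty : Balanced [] []
    graft : ∀ {cs ts a u v} → Balanced cs u → Balanced ts v → Balanced (node cs ∷ ts) (a ∷ u ++ comp a ∷ v)

  graft-≡ : ∀ {cs ts a b u v} → b ≡ comp a → Balanced cs u → Balanced ts v
          → Balanced (node cs ∷ ts) (a ∷ u ++ b ∷ v)
  graft-≡ refl = graft

  module _ (P : Word 𝒜) where

    -- w occupies positions o + 1, …, o + length w of P.
    Segment : ℕ → Word 𝒜 → Set
    Segment o w = ∃[ pre ] ∃[ post ] (P ≡ pre ++ w ++ post × length pre ≡ o)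

    segment-whole : Segment 0 P
    segment-whole = [] , [] , sym (++-identityʳ P) , refl

    segment-head : ∀ {o x w} → Segment o (x ∷ w) → _at_ 𝒜 P (suc o) ≡ just x
    segment-head {x = x} {w} (pre , post , refl , refl) = at-++-∷ pre x (w ++ post)

    segment-++ˡ : ∀ {o} xs {ys} → Segment o (xs ++ ys) → Segment o xs
    segment-++ˡ xs {ys} (pre , post , refl , refl) =
      pre , ys ++ post , cong (pre ++_) (++-assoc xs ys post) , refl

    segment-++ʳ : ∀ {o} xs {ys} → Segment o (xs ++ ys) → Segment (length xs + o) ys
    segment-++ʳ xs {ys} (pre , post , refl , refl) =
      pre ++ xs , post ,
      trans (cong (pre ++_) (++-assoc xs ys post)) (sym (++-assoc pre xs (ys ++ post))) ,
      trans (length-++ pre) (+-comm (length pre) (length xs))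

    segment-tail : ∀ {o x w} → Segment o (x ∷ w) → Segment (suc o) w
    segment-tail {x = x} = segment-++ʳ [ x ]

    ComplEdges : List (ℕ × ℕ) → Set
    ComplEdges es = ∀ {i j} → (i , j) ∈ es → ComplAt 𝒜 P i j

    complEdges⇒balanced : ∀ ts {o w} → Segment o w → length w ≡ 2 * sizeF ts
                        → ComplEdges (edgesF o ts) → Balanced ts w
    complEdges⇒balanced [] {w = []} _ _ _ = empty
    complEdges⇒balanced (node cs ∷ ts) {o} {a ∷ w} seg len compl
      with splitAt-length (2 * sizeF cs) (suc (2 * sizeF ts)) w
             (suc-injective (trans len (2*suc-+ (sizeF cs) (sizeF ts))))
    ... | u , b ∷ v , refl , lu , lv =
      graft-≡ (ComplAt⇒≡comp {P = P} (segment-head seg) (segment-head segB) (compl (here refl)))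
        (complEdges⇒balanced cs (segment-++ˡ u (segment-tail seg)) lu (λ m → compl (there (∈-++⁺ˡ m))))
        (complEdges⇒balanced ts (segment-tail segB) (suc-injective lv)
          (λ m → compl (there (∈-++⁺ʳ (edgesF (suc o) cs) m))))
      where
      segB : Segment (o + suc (2 * sizeF cs)) (b ∷ v)
      segB = subst (λ k → Segment k (b ∷ v))
               (trans (cong (_+ suc o) lu) (trans (+-comm (2 * sizeF cs) (suc o)) (sym (+-suc o _))))
               (segment-++ʳ u (segment-tail seg))

    LetterAt : ℕ × Letter 𝒜 → Set
    LetterAt (j , y) = _at_ 𝒜 P j ≡ just y

    greedyGo-complEdges : ∀ o st w → Segment o w → All LetterAt st
                        → ComplEdges (proj₁ (greedyGo 𝒜 (suc o) st w))
    greedyGo-complEdges o [] (x ∷ w) seg _ =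
      greedyGo-complEdges (suc o) _ w (segment-tail seg) (segment-head seg ∷ [])
    greedyGo-complEdges o ((j , y) ∷ st) (x ∷ w) seg (at-j ∷ at-st) with x ≟ comp y
    ... | yes x≡cy = λ where
      (here refl) → y , x , at-j , segment-head seg , x≡cy
      (there m)   → greedyGo-complEdges (suc o) st w (segment-tail seg) at-st m
    ... | no _ = greedyGo-complEdges (suc o) _ w (segment-tail seg) (segment-head seg ∷ at-j ∷ at-st)

  push : Letter 𝒜 → List (Letter 𝒜) → List (Letter 𝒜)
  push x []      = x ∷ []
  push x (y ∷ s) with x ≟ comp y
  ... | yes _ = s
  ... | no _  = x ∷ y ∷ s

  reduce : List (Letter 𝒜) → Word 𝒜 → List (Letter 𝒜)
  reduce = foldl (λ s x → push x s)

  -- No two adjacent letters of the stack cancel.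
  Reduced : List (Letter 𝒜) → Set
  Reduced []      = ⊤
  Reduced (y ∷ s) = push y s ≡ y ∷ s × Reduced s

  push-≢ : ∀ {x y} s → x ≢ comp y → push x (y ∷ s) ≡ x ∷ y ∷ s
  push-≢ {x} {y} s x≢cy with x ≟ comp y
  ... | yes x≡cy = ⊥-elim (x≢cy x≡cy)
  ... | no _     = refl

  push-comp : ∀ a s → push (comp a) (a ∷ s) ≡ s
  push-comp a s with comp a ≟ comp a
  ... | yes _ = refl
  ... | no ca≢ca = ⊥-elim (ca≢ca refl)

  push-reduced : ∀ x s → Reduced s → Reduced (push x s)
  push-reduced x []      _       = refl , tt
  push-reduced x (y ∷ s) (p , r) with x ≟ comp y
  ... | yes _    = r
  ... | no x≢cy  = push-≢ s x≢cy , p , r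

  push-comp-push : ∀ a s → Reduced s → push (comp a) (push a s) ≡ s
  push-comp-push a []      _       = push-comp a []
  push-comp-push a (y ∷ s) (p , _) with a ≟ comp y
  ... | yes refl rewrite comp-invol y = p
  ... | no _     = push-comp a (y ∷ s)

  reduce-balanced : ∀ {ts w} → Balanced ts w → ∀ s → Reduced s → reduce s w ≡ s
  reduce-balanced empty s _ = refl
  reduce-balanced (graft {a = a} {u} {v} bu bv) s r = begin
    reduce s (a ∷ u ++ comp a ∷ v)              ≡⟨ foldl-++ _ (push a s) u (comp a ∷ v) ⟩
    reduce (push (comp a) (reduce (push a s) u)) v
      ≡⟨ cong (λ t → reduce (push (comp a) t) v) (reduce-balanced bu (push a s) (push-reduced a s r)) ⟩
    reduce (push (comp a) (push a s)) v         ≡⟨ cong (λ t → reduce t v) (push-comp-push a s r) ⟩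
    reduce s v                                  ≡⟨ reduce-balanced bv s r ⟩
    s                                           ∎
    where open ≡-Reasoning

  greedyGo-letters : ∀ i st w → map proj₂ (proj₂ (greedyGo 𝒜 i st w)) ≡ reduce (map proj₂ st) w
  greedyGo-letters i st [] = refl
  greedyGo-letters i [] (x ∷ w) = greedyGo-letters (suc i) _ w
  greedyGo-letters i ((j , y) ∷ st) (x ∷ w) with x ≟ comp y
  ... | yes _ = greedyGo-letters (suc i) st w
  ... | no _  = greedyGo-letters (suc i) _ w

  balanced⇒greedy-matches-all : ∀ {ts P} → Balanced ts P → proj₂ (greedy 𝒜 P) ≡ []
  balanced⇒greedy-matches-all {P = P} b =
    map-≡[] _ (trans (greedyGo-letters 1 [] P) (reduce-balanced b [] tt))

  -- The greedy stack with, under each open position, the subtrees already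
  -- completed below that edge; the root holds the completed top-level forest.
  data Zipper : List (ℕ × Letter 𝒜) → Set where
    root    : List PlaneTree → Zipper []
    pending : ∀ {st} j y → List PlaneTree → Zipper st → Zipper ((j , y) ∷ st)

  close : ∀ {j y st} → Zipper ((j , y) ∷ st) → Zipper st
  close (pending _ _ F (root G))           = root (G ++ [ node F ])
  close (pending _ _ F (pending j y G z))  = pending j y (G ++ [ node F ]) z

  run : ∀ i {st} w → Zipper st → Zipper (proj₂ (greedyGo 𝒜 i st w))
  run i []      z = z
  run i {[]} (x ∷ w) z = run (suc i) w (pending i x [] z)
  run i {(j , y) ∷ st} (x ∷ w) z with x ≟ comp y
  ... | yes _ = run (suc i) w (close z)
  ... | no _  = run (suc i) w (pending i x [] z)

  zipperEdges : ∀ {st} → Zipper st → List (ℕ × ℕ)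
  zipperEdges (root G)          = edgesF 0 G
  zipperEdges (pending j _ F z) = edgesF j F ++ zipperEdges z

  -- i is the next position to be read.
  Consistent : ∀ {st} → ℕ → Zipper st → Set
  Consistent i (root G)          = i ≡ suc (2 * sizeF G)
  Consistent i (pending j _ F z) = i ≡ suc (j + 2 * sizeF F) × Consistent j z

  pending-consistent : ∀ {st i} x (z : Zipper st) → Consistent i z → Consistent (suc i) (pending i x [] z)
  pending-consistent {i = i} _ _ c = cong suc (sym (+-identityʳ i)) , c

  close-consistent : ∀ {i j y st} (z : Zipper ((j , y) ∷ st)) → Consistent i z → Consistent (suc i) (close z)
  close-consistent (pending _ _ F (root G))          (i≡ , j≡)     = edgesF-snoc-end 0 G F j≡ i≡
  close-consistent (pending _ _ F (pending j _ G z)) (i≡ , j≡ , c) = edgesF-snoc-end j G F j≡ i≡ , c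

  close-edges : ∀ {i j y st} (z : Zipper ((j , y) ∷ st)) → Consistent i z
              → zipperEdges (close z) ↭ (j , i) ∷ zipperEdges z
  close-edges (pending _ _ F (root G))          (i≡ , j≡)     = edgesF-snoc 0 G F j≡ i≡
  close-edges (pending _ _ F (pending j _ G z)) (i≡ , j≡ , _) =
    ↭-trans (↭.++⁺ʳ (zipperEdges z) (edgesF-snoc j G F j≡ i≡))
            (↭-reflexive (cong (_ ∷_) (++-assoc _ (edgesF j G) (zipperEdges z))))

  run-consistent : ∀ i {st} w (z : Zipper st) → Consistent i z → Consistent (i + length w) (run i w z)
  run-consistent i [] z c = subst (λ k → Consistent k z) (sym (+-identityʳ i)) c
  run-consistent i {[]} (x ∷ w) z c rewrite +-suc i (length w) =
    run-consistent (suc i) w (pending i x [] z) (pending-consistent x z c)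
  run-consistent i {(j , y) ∷ st} (x ∷ w) z c rewrite +-suc i (length w) with x ≟ comp y
  ... | yes _ = run-consistent (suc i) w (close z) (close-consistent z c)
  ... | no _  = run-consistent (suc i) w (pending i x [] z) (pending-consistent x z c)

  run-edges : ∀ i {st} w (z : Zipper st) → Consistent i z
            → proj₁ (greedyGo 𝒜 i st w) ++ zipperEdges z ↭ zipperEdges (run i w z)
  run-edges i [] z c = ↭-refl
  run-edges i {[]} (x ∷ w) z c = run-edges (suc i) w (pending i x [] z) (pending-consistent x z c)
  run-edges i {(j , y) ∷ st} (x ∷ w) z c with x ≟ comp y
  ... | yes _ =
    ↭-trans (↭-sym (↭.shift (j , i) pairs (zipperEdges z)))
      (↭-trans (↭.++⁺ˡ pairs (↭-sym (close-edges z c)))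
        (run-edges (suc i) w (close z) (close-consistent z c)))
    where
    pairs : List (ℕ × ℕ)
    pairs = proj₁ (greedyGo 𝒜 (suc i) st w)
  ... | no _  = run-edges (suc i) w (pending i x [] z) (pending-consistent x z c)

  root-forest : ∀ {st k} (z : Zipper st) → st ≡ [] → Consistent k z
              → ∃[ G ] (zipperEdges z ≡ edgesF 0 G × k ≡ suc (2 * sizeF G))
  root-forest (root G) refl c = G , refl , c

  greedy-tree : ∀ n P → length P ≡ 2 * n → proj₂ (greedy 𝒜 P) ≡ []
              → ∃[ T ] (edgeCount T ≡ n
                        × (∀ i j → ((i , j) ∈ proj₁ (greedy 𝒜 P) ⇔ (i , j) ∈ edges T))
                        × Valid 𝒜 P T)
  greedy-tree n P len matched
    with root-forest (run 1 P (root [])) matched (run-consistent 1 P (root []) refl)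
  ... | G , edges≡ , end≡ =
    node G , sizeF≡n , (λ i j → mk⇔ (↭.∈-resp-↭ pairs↭edges) (↭.∈-resp-↭ (↭-sym pairs↭edges))) ,
    λ m → greedyGo-complEdges P 0 [] P (segment-whole P) [] (↭.∈-resp-↭ (↭-sym pairs↭edges) m)
    where
    pairs↭edges : proj₁ (greedy 𝒜 P) ↭ edgesF 0 G
    pairs↭edges = ↭-trans (↭-sym (↭.++-identityʳ _))
                    (subst (_ ↭_) edges≡ (run-edges 1 P (root []) refl))
    sizeF≡n : sizeF G ≡ n
    sizeF≡n = *-cancelˡ-≡ (sizeF G) n 2 (trans (sym (suc-injective end≡)) len)

mainTheorem1 : (𝒜 : ComplementaryAlphabet) (n : ℕ) (P : Word 𝒜)
    → length P ≡ 2 * n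
    → ∃[ T ] (edgeCount T ≡ n × Valid 𝒜 P T)
    → proj₂ (greedy 𝒜 P) ≡ []
      × ∃[ T ] (edgeCount T ≡ n
                × (∀ i j → ((i , j) ∈ proj₁ (greedy 𝒜 P) ⇔ (i , j) ∈ edges T))
                × Valid 𝒜 P T)
mainTheorem1 𝒜 n P len (node cs , refl , valid) = matched , greedy-tree 𝒜 n P len matched
  where
  matched : proj₂ (greedy 𝒜 P) ≡ []
  matched = balanced⇒greedy-matches-all 𝒜
              (complEdges⇒balanced 𝒜 P cs (segment-whole 𝒜 P) len valid)
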